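{- Let $(G,G_c,k,d)$ be an instance of \textsc{DC Completion (Edge Dist)}, let $D_1,\dots,D_q$ be the cliques (clusters) of $G_c$, and let $C_0,C_1,\dots,C_r$ with $r\ge 1$ be isolated cliques in $G$ (vertex sets inducing cliques with no edges of $G$ leaving them). Let $E^*=\{\{u,v\}\mid u\in C_0,\ v\in C_1\cup\dots\cup C_r\}$. If $T(C_0)=0$, or if $T(C_0)\ne T(C_i)$ for all $1\le i\le r$, then $|E^*\cap E(G_c)|\le |E^*\setminus E(G_c)|$.
   Context: A cluster graph is a disjoint union of cliques. \textsc{DC Completion (Edge Dist)}: given a graph $G$ and a cluster graph $G_c$ on the same vertex set and nonnegative integers $k,d$, decide whether there is a cluster graph $G'$ with $E(G)\subseteq E(G')$, $|E(G)\oplus E(G')|\le k$ and $|E(G')\oplus E(G_c)|\le d$. For a vertex set $C$, $T(C)=i$ if there is an index $i\in\{1,\dots,q\}$ with $|C\cap D_i|>\frac12|C|$, and $T(C)=0$ otherwise. -}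

module Defs where

open import Data.Nat using (ℕ; zero; suc; _+_; _*_; _<_)
open import Data.Nat.Properties using (_<?_)
open import Data.Fin using (Fin; zero; suc; toℕ)
open import Data.Fin.Properties using () renaming (_≟_ to _≟ᶠ_)
open import Data.Fin.Subset using (Subset; _∩_; ∣_∣; _∈_; _∉_)
open import Data.Vec using (lookup; tabulate)
open import Data.Bool using (Bool; true; false; _∧_; _∨_; not; if_then_else_)
open import Data.List using (List; allFin; filter; foldr; map)
open import Data.Nat.ListAction using (sum)
open import Data.Maybe using (Maybe; just; nothing)
open import Data.Product using (∃)
open import Relation.Nullary using (¬_; does)
open import Relation.Binary.PropositionalEquality using (_≡_; _≢_)
open import Function.Definitions using (Surjective)

record Graph (n : ℕ) : Set₁ where
  field
    Adj   : Fin n → Fin n → Set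
    sym   : ∀ {u v} → Adj u v → Adj v u
    irrefl : ∀ {u} → ¬ Adj u u
open Graph public

-- A cluster graph on Fin n with clusters D_1..D_q, given by a surjective
-- cluster-label function (cluster of vertex v is label v); D i ≠ ∅.
record ClusterGraph (n q : ℕ) : Set where
  field
    label : Fin n → Fin q
    onto  : Surjective _≡_ _≡_ label
open ClusterGraph public

D : ∀ {n q} → ClusterGraph n q → Fin q → Subset n
D Gc i = tabulate (λ v → does (label Gc v ≟ᶠ i))

-- uv ∈ E(G_c)  (for u ≠ v): same cluster
adjC : ∀ {n q} → ClusterGraph n q → Fin n → Fin n → Bool
adjC Gc u v = does (label Gc u ≟ᶠ label Gc v)

-- |C ∩ D_i| > |C|/2, i.e. 2|C ∩ D_i| > |C|
majority? : ∀ {n q} (Gc : ClusterGraph n q) (C : Subset n) (i : Fin q) → Bool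
majority? Gc C i = does (∣ C ∣ <? 2 * ∣ C ∩ D Gc i ∣)

firstJust : ∀ {A : Set} → List A → Maybe A
firstJust = foldr (λ a _ → just a) nothing

-- T(C): just i if i is a (necessarily unique) majority cluster, nothing for T(C)=0
T : ∀ {n q} → ClusterGraph n q → Subset n → Maybe (Fin q)
T Gc C = firstJust (filter (λ i → majority? Gc C i ≟ᵇ true) (allFin _))
  where open import Data.Bool.Properties using () renaming (_≟_ to _≟ᵇ_)

IsolatedClique : ∀ {n} → Graph n → Subset n → Set
IsolatedClique G C =
  (∀ u v → u ∈ C → v ∈ C → u ≢ v → Adj G u v) ×'
  (∀ u v → u ∈ C → v ∉ C → ¬ Adj G u v)
  where open import Data.Product renaming (_×_ to _×'_)

-- number of unordered pairs {u,v} (u ≠ v) satisfying a symmetric-in-use predicate P,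
-- counted as pairs with toℕ u < toℕ v and (P u v or P v u)
countPairs : ∀ {n} → (Fin n → Fin n → Bool) → ℕ
countPairs {n} P =
  sum (map (λ u → sum (map (λ v →
    if does (toℕ u <? toℕ v) ∧ (P u v ∨ P v u) then 1 else 0) (allFin n))) (allFin n))

inUnion : ∀ {n r} → (Fin r → Subset n) → Fin n → Bool
inUnion {r = r} Cs v = foldr (λ i b → lookup (Cs i) v ∨ b) false (allFin r)

-- (u,v) with u ∈ C0 and v ∈ C1 ∪ ... ∪ Cr, i.e. {u,v} ∈ E* when oriented this way
inEstar : ∀ {n r} → Subset n → (Fin r → Subset n) → Fin n → Fin n → Bool
inEstar C0 Cs u v = lookup C0 u ∧ inUnion Cs v

EstarInGc : ∀ {n q r} → ClusterGraph n q → Subset n → (Fin r → Subset n) → ℕ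
EstarInGc Gc C0 Cs = countPairs (λ u v → inEstar C0 Cs u v ∧ adjC Gc u v)

EstarNotGc : ∀ {n q r} → ClusterGraph n q → Subset n → (Fin r → Subset n) → ℕ
EstarNotGc Gc C0 Cs = countPairs (λ u v → inEstar C0 Cs u v ∧ not (adjC Gc u v))

module Submission where

-- Lemma 3.2.  Write U = C₁ ∪ … ∪ Cᵣ and ℓ(v) for the cluster of v in G_c.
-- Because C₀ and U are disjoint, each pair of E* is counted exactly once by
-- an ordered pair (u , v) with u ∈ C₀ and v ∈ U, hence
--   |E* ∩ E(G_c)| = Σ_{v ∈ U} in(v)   and   |E* ∖ E(G_c)| = Σ_{v ∈ U} out(v),
-- where in(v) = |C₀ ∩ D_ℓ(v)| and in(v) + out(v) = |C₀|.
--  * If T(C₀) = 0, no cluster holds a strict majority of C₀, so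
--    in(v) ≤ out(v) for every v and the inequality holds termwise.
--  * If T(C₀) = i, let c = |C₀ ∩ D_i| and e = |C₀| - c ≤ c.  Vertices of U in
--    D_i have in = c and out = e; all other vertices have in ≤ e and out ≥ c.
--    As D_i is a majority in no Cₗ, at most half of U lies in D_i, and the
--    exchange inequality Mc + Pe ≤ Me + Pc (for M ≤ P, e ≤ c) concludes.

open import Defs hiding (sym)
open import Data.Nat using (ℕ; zero; suc; _+_; _*_; _∸_; _<_; _≤_; z≤n)
open import Data.Fin using (Fin; zero; suc; toℕ)
open import Data.Fin.Subset using (Subset; Empty; _∩_; ∣_∣)
open import Data.Maybe using (nothing; just)
open import Data.Sum using (_⊎_; inj₁; inj₂)
open import Relation.Binary.PropositionalEquality using (_≡_)
open import Relation.Nullary using (¬_; Dec; does; yes; no; contradiction)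
open import Data.Nat.Properties
  using ( +-*-semiring; _<?_; <-cmp; ≤-refl; ≤-reflexive; ≤-trans; <⇒≤; <-irrefl
        ; +-comm; +-identityʳ; *-identityˡ; *-zeroʳ; *-distribˡ-+
        ; +-mono-≤; +-mono-<; *-monoʳ-≤; m≤m+n
        ; +-cancelˡ-≤; +-cancelˡ-<; +-cancelˡ-≡; +-cancelʳ-≤; m+[n∸m]≡n; ≮⇒≥
        ; module ≤-Reasoning )
open import Data.Nat.Tactic.RingSolver using (solve-∀)
open import Data.Nat.ListAction using () renaming (sum to listSum)
open import Data.Fin.Properties using (toℕ-injective; suc-injective) renaming (_≟_ to _≟ᶠ_)
open import Data.Fin.Subset.Properties using (x∈p∩q⁺; ∣p∩q∣≤∣p∣)
open import Data.Bool using (Bool; true; false; _∧_; _∨_; not; if_then_else_)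
open import Data.Bool.Properties using (∧-zeroʳ; ∧-identityʳ) renaming (_≟_ to _≟ᵇ_)
open import Data.List using (List; []; _∷_; allFin; filter; map; foldr; tabulate)
open import Data.List.Membership.Propositional using (_∈_)
open import Data.List.Membership.Propositional.Properties using (∈-allFin; ∈-filter⁺; ∈-filter⁻)
open import Data.List.Relation.Unary.Any using (here)
open import Data.Vec using ([]; _∷_; lookup)
open import Data.Vec.Properties using (lookup-zipWith; lookup∘tabulate; lookup⇒[]=)
open import Data.Product using (_,_; proj₂)
open import Data.Empty using (⊥-elim)
open import Function using (_∘_)
open import Relation.Binary.Definitions using (tri<; tri≈; tri>)
open import Relation.Binary.PropositionalEquality
  using (_≢_; refl; sym; trans; cong; cong₂; subst; subst₂; module ≡-Reasoning)
open import Relation.Nullary.Decidable using (dec-true; dec-false)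
open import Algebra.Properties.Semiring.Sum +-*-semiring
  using (sum; sum-syntax; sum-cong-≗; sum-replicate-zero; ∑-distrib-+; ∑-comm; *-distribˡ-sum; *-distribʳ-sum)

⟦_⟧ : Bool → ℕ
⟦ b ⟧ = if b then 1 else 0

⟦∧⟧ : ∀ a b → ⟦ a ∧ b ⟧ ≡ ⟦ a ⟧ * ⟦ b ⟧
⟦∧⟧ false b = refl
⟦∧⟧ true  b = sym (*-identityˡ ⟦ b ⟧)

⟦∧⟧+⟦∧not⟧ : ∀ a b → ⟦ a ∧ b ⟧ + ⟦ a ∧ not b ⟧ ≡ ⟦ a ⟧
⟦∧⟧+⟦∧not⟧ false b     = refl
⟦∧⟧+⟦∧not⟧ true  false = refl
⟦∧⟧+⟦∧not⟧ true  true  = refl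

⟦∧∨⟧ : ∀ c a b → a ∧ b ≡ false → ⟦ c ∧ (a ∨ b) ⟧ ≡ ⟦ c ∧ a ⟧ + ⟦ c ∧ b ⟧
⟦∧∨⟧ false a     b     _ = refl
⟦∧∨⟧ true  false b     _ = refl
⟦∧∨⟧ true  true  false _ = refl
⟦∧∨⟧ true  true  true  ()

⟦∧∧⟧ : ∀ a b z → ⟦ (a ∧ b) ∧ z ⟧ ≡ ⟦ b ⟧ * ⟦ a ∧ z ⟧
⟦∧∧⟧ false b     z = sym (*-zeroʳ ⟦ b ⟧)
⟦∧∧⟧ true  false z = refl
⟦∧∧⟧ true  true  z = sym (*-identityˡ ⟦ z ⟧)

-- Pointwise form of the exchange argument: a quantity x counted with weight
-- ⟦ w ⟧ is bounded by a where z holds and by b where z fails (and dually).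
weighted-≤ : ∀ w z {x a b} → (z ≡ true → x ≤ a) → (z ≡ false → x ≤ b) →
  ⟦ w ⟧ * x ≤ ⟦ w ∧ z ⟧ * a + ⟦ w ∧ not z ⟧ * b
weighted-≤ false z     _   _   = z≤n
weighted-≤ true  true  {a = a} {b} x≤a _ = ≤-trans (*-monoʳ-≤ 1 (x≤a refl)) (m≤m+n (1 * a) (0 * b))
weighted-≤ true  false _ x≤b = *-monoʳ-≤ 1 (x≤b refl)

weighted-≥ : ∀ w z {x a b} → (z ≡ true → a ≤ x) → (z ≡ false → b ≤ x) →
  ⟦ w ∧ z ⟧ * a + ⟦ w ∧ not z ⟧ * b ≤ ⟦ w ⟧ * x
weighted-≥ false z     _   _   = z≤n
weighted-≥ true  true  {a = a} a≤x _ = ≤-trans (≤-reflexive (+-identityʳ (1 * a))) (*-monoʳ-≤ 1 (a≤x refl))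
weighted-≥ true  false _ b≤x = *-monoʳ-≤ 1 (b≤x refl)

does-true : ∀ {P : Set} (d : Dec P) → does d ≡ true → P
does-true (yes p) _ = p

does-false : ∀ {P : Set} (d : Dec P) → does d ≡ false → ¬ P
does-false (no ¬p) _ = ¬p

∑-mono-≤ : ∀ {n} {f g : Fin n → ℕ} → (∀ i → f i ≤ g i) → sum f ≤ sum g
∑-mono-≤ {zero}  _   = z≤n
∑-mono-≤ {suc n} f≤g = +-mono-≤ (f≤g zero) (∑-mono-≤ (f≤g ∘ suc))

∑-split : ∀ {n} (a b : Fin n → Bool) →
  ∑[ u < n ] ⟦ a u ∧ b u ⟧ + ∑[ u < n ] ⟦ a u ∧ not (b u) ⟧ ≡ ∑[ u < n ] ⟦ a u ⟧
∑-split a b = trans (sym (∑-distrib-+ (λ u → ⟦ a u ∧ b u ⟧) (λ u → ⟦ a u ∧ not (b u) ⟧)))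
                    (sum-cong-≗ (λ u → ⟦∧⟧+⟦∧not⟧ (a u) (b u)))

∑∑-distrib-+ : ∀ {m n} (f g : Fin m → Fin n → ℕ) →
  ∑[ u < m ] ∑[ v < n ] (f u v + g u v) ≡ ∑[ u < m ] ∑[ v < n ] f u v + ∑[ u < m ] ∑[ v < n ] g u v
∑∑-distrib-+ f g = trans (sum-cong-≗ (λ u → ∑-distrib-+ (f u) (g u)))
  (∑-distrib-+ (λ u → sum (f u)) (λ u → sum (g u)))

-- A list sum over a tabulation is a finite sum (allFin n = tabulate id).
listSum-tabulate : ∀ {A : Set} {n} (f : A → ℕ) (g : Fin n → A) →
  listSum (map f (tabulate g)) ≡ ∑[ i < n ] f (g i)
listSum-tabulate {n = zero}  f g = refl
listSum-tabulate {n = suc n} f g = cong (f (g zero) +_) (listSum-tabulate f (g ∘ suc))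

∣∣-as-∑ : ∀ {n} (S : Subset n) → ∣ S ∣ ≡ ∑[ u < n ] ⟦ lookup S u ⟧
∣∣-as-∑ []          = refl
∣∣-as-∑ (true  ∷ S) = cong suc (∣∣-as-∑ S)
∣∣-as-∑ (false ∷ S) = ∣∣-as-∑ S

⟦any⟧ : ∀ {A : Set} {r} (b : A → Bool) (g : Fin r → A) →
  (∀ {i j} → i ≢ j → b (g i) ≡ true → b (g j) ≡ false) →
  ⟦ foldr (λ a acc → b a ∨ acc) false (tabulate g) ⟧ ≡ ∑[ i < r ] ⟦ b (g i) ⟧
⟦any⟧ {r = zero}  b g exclusive = refl
⟦any⟧ {r = suc r} b g exclusive with b (g zero) in b₀
... | false = ⟦any⟧ b (g ∘ suc) (λ i≢j → exclusive (i≢j ∘ suc-injective))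
... | true  = cong suc (sym (trans (sum-cong-≗ {x = λ l → ⟦ b (g (suc l)) ⟧} rest-false)
                                   (sum-replicate-zero r)))
  where
  rest-false : ∀ l → ⟦ b (g (suc l)) ⟧ ≡ 0
  rest-false l = cong ⟦_⟧ (exclusive (λ ()) b₀)

-- Exchange inequality: if M ≤ P and e ≤ c then Mc + Pe ≤ Me + Pc, since the
-- difference is (P - M)(c - e).
rearrangement : ∀ {M P e c} → M ≤ P → e ≤ c → M * c + P * e ≤ M * e + P * c
rearrangement {M} {P} {e} {c} M≤P e≤c =
  subst₂ (λ P c → M * c + P * e ≤ M * e + P * c) (m+[n∸m]≡n M≤P) (m+[n∸m]≡n e≤c)
    (subst (M * (e + d) + (M + p) * e ≤_) (expand M p e d) (m≤m+n _ (p * d)))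
  where
  p d : ℕ
  p = P ∸ M
  d = c ∸ e
  expand : ∀ M p e d → M * (e + d) + (M + p) * e + p * d ≡ M * e + (M + p) * (e + d)
  expand = solve-∀

exchange : ∀ {n} (h m f g : Fin n → ℕ) {c e : ℕ} → e ≤ c → sum h ≤ sum m →
  (∀ v → f v ≤ h v * c + m v * e) → (∀ v → h v * e + m v * c ≤ g v) → sum f ≤ sum g
exchange {n} h m f g {c} {e} e≤c H≤M f-bound g-bound = begin
  sum f                                     ≤⟨ ∑-mono-≤ f-bound ⟩
  ∑[ v < n ] (h v * c + m v * e)            ≡⟨ linear c e ⟩
  sum h * c + sum m * e                     ≤⟨ rearrangement H≤M e≤c ⟩
  sum h * e + sum m * c                     ≡⟨ linear e c ⟨
  ∑[ v < n ] (h v * e + m v * c)            ≤⟨ ∑-mono-≤ g-bound ⟩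
  sum g                                     ∎
  where
  open ≤-Reasoning
  linear : ∀ a b → ∑[ v < n ] (h v * a + m v * b) ≡ sum h * a + sum m * b
  linear a b = trans (∑-distrib-+ (λ v → h v * a) (λ v → m v * b))
                     (cong₂ _+_ (sym (*-distribʳ-sum a h)) (sym (*-distribʳ-sum b m)))

precedes : ∀ {n} → Fin n → Fin n → Bool
precedes u v = does (toℕ u <? toℕ v)

countPairs-∑ : ∀ {n} (P : Fin n → Fin n → Bool) →
  countPairs P ≡ ∑[ u < n ] ∑[ v < n ] ⟦ precedes u v ∧ (P u v ∨ P v u) ⟧
countPairs-∑ {n} P = trans (listSum-tabulate (λ u → listSum (map (pair u) (allFin n))) (λ u → u))
                           (sum-cong-≗ (λ u → listSum-tabulate (pair u) (λ v → v)))
  where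
  pair : Fin n → Fin n → ℕ
  pair u v = ⟦ precedes u v ∧ (P u v ∨ P v u) ⟧

one-orientation : ∀ {n} {u v : Fin n} → u ≢ v → ⟦ precedes u v ⟧ + ⟦ precedes v u ⟧ ≡ 1
one-orientation {u = u} {v} u≢v with <-cmp (toℕ u) (toℕ v)
... | tri< u<v _ v≮u = cong₂ (λ a b → ⟦ a ⟧ + ⟦ b ⟧) (dec-true (toℕ u <? toℕ v) u<v) (dec-false (toℕ v <? toℕ u) v≮u)
... | tri≈ _ u≡v _   = ⊥-elim (u≢v (toℕ-injective u≡v))
... | tri> u≮v _ v<u = cong₂ (λ a b → ⟦ a ⟧ + ⟦ b ⟧) (dec-false (toℕ u <? toℕ v) u≮v) (dec-true (toℕ v <? toℕ u) v<u)

orientations : ∀ {n} (u v : Fin n) (p : Bool) → (p ≡ true → u ≢ v) →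
  ⟦ precedes u v ∧ p ⟧ + ⟦ precedes v u ∧ p ⟧ ≡ ⟦ p ⟧
orientations u v false _ =
  cong₂ (λ a b → ⟦ a ⟧ + ⟦ b ⟧) (∧-zeroʳ (precedes u v)) (∧-zeroʳ (precedes v u))
orientations u v true p⇒u≢v =
  trans (cong₂ (λ a b → ⟦ a ⟧ + ⟦ b ⟧) (∧-identityʳ (precedes u v)) (∧-identityʳ (precedes v u)))
        (one-orientation (p⇒u≢v refl))

countPairs-asym : ∀ {n} (P : Fin n → Fin n → Bool) → (∀ u v → P u v ∧ P v u ≡ false) →
  countPairs P ≡ ∑[ u < n ] ∑[ v < n ] ⟦ P u v ⟧
countPairs-asym {n} P asym = begin
  countPairs P
    ≡⟨ countPairs-∑ P ⟩
  ∑[ u < n ] ∑[ v < n ] ⟦ precedes u v ∧ (P u v ∨ P v u) ⟧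
    ≡⟨ sum-cong-≗ (λ u → sum-cong-≗ (λ v → ⟦∧∨⟧ (precedes u v) (P u v) (P v u) (asym u v))) ⟩
  ∑[ u < n ] ∑[ v < n ] (⟦ precedes u v ∧ P u v ⟧ + ⟦ precedes u v ∧ P v u ⟧)
    ≡⟨ ∑∑-distrib-+ (λ u v → ⟦ precedes u v ∧ P u v ⟧) (λ u v → ⟦ precedes u v ∧ P v u ⟧) ⟩
  ∑[ u < n ] ∑[ v < n ] ⟦ precedes u v ∧ P u v ⟧ + ∑[ u < n ] ∑[ v < n ] ⟦ precedes u v ∧ P v u ⟧
    ≡⟨ cong (∑[ u < n ] ∑[ v < n ] ⟦ precedes u v ∧ P u v ⟧ +_) (∑-comm (λ u v → ⟦ precedes u v ∧ P v u ⟧)) ⟩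
  ∑[ u < n ] ∑[ v < n ] ⟦ precedes u v ∧ P u v ⟧ + ∑[ u < n ] ∑[ v < n ] ⟦ precedes v u ∧ P u v ⟧
    ≡⟨ ∑∑-distrib-+ (λ u v → ⟦ precedes u v ∧ P u v ⟧) (λ u v → ⟦ precedes v u ∧ P u v ⟧) ⟨
  ∑[ u < n ] ∑[ v < n ] (⟦ precedes u v ∧ P u v ⟧ + ⟦ precedes v u ∧ P u v ⟧)
    ≡⟨ sum-cong-≗ (λ u → sum-cong-≗ (λ v → orientations u v (P u v) (irreflexive u v))) ⟩
  ∑[ u < n ] ∑[ v < n ] ⟦ P u v ⟧ ∎
  where
  open ≡-Reasoning
  irreflexive : ∀ u v → P u v ≡ true → u ≢ v
  irreflexive u .u Puu refl with trans (sym (cong₂ _∧_ Puu Puu)) (asym u u)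
  ... | ()

module Clusters {n q : ℕ} (Gc : ClusterGraph n q) where

  inCluster : Fin q → Fin n → Bool
  inCluster j u = does (label Gc u ≟ᶠ j)

  ∣∩D∣-as-∑ : ∀ C j → ∣ C ∩ D Gc j ∣ ≡ ∑[ u < n ] ⟦ lookup C u ∧ inCluster j u ⟧
  ∣∩D∣-as-∑ C j = trans (∣∣-as-∑ (C ∩ D Gc j)) (sum-cong-≗ (λ u → cong ⟦_⟧
    (trans (lookup-zipWith _∧_ u C (D Gc j)) (cong (lookup C u ∧_) (lookup∘tabulate (inCluster j) u)))))

  ∣∩D∣+∣∩D∣≤∣∣ : ∀ C {i j} → i ≢ j → ∣ C ∩ D Gc i ∣ + ∣ C ∩ D Gc j ∣ ≤ ∣ C ∣
  ∣∩D∣+∣∩D∣≤∣∣ C {i} {j} i≢j = begin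
    ∣ C ∩ D Gc i ∣ + ∣ C ∩ D Gc j ∣
      ≡⟨ cong₂ _+_ (∣∩D∣-as-∑ C i) (∣∩D∣-as-∑ C j) ⟩
    ∑[ u < n ] ⟦ lookup C u ∧ inCluster i u ⟧ + ∑[ u < n ] ⟦ lookup C u ∧ inCluster j u ⟧
      ≡⟨ ∑-distrib-+ (λ u → ⟦ lookup C u ∧ inCluster i u ⟧) (λ u → ⟦ lookup C u ∧ inCluster j u ⟧) ⟨
    ∑[ u < n ] (⟦ lookup C u ∧ inCluster i u ⟧ + ⟦ lookup C u ∧ inCluster j u ⟧)
      ≤⟨ ∑-mono-≤ one-cluster ⟩
    ∑[ u < n ] ⟦ lookup C u ⟧
      ≡⟨ ∣∣-as-∑ C ⟨
    ∣ C ∣ ∎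
    where
    open ≤-Reasoning
    one-cluster : ∀ u → ⟦ lookup C u ∧ inCluster i u ⟧ + ⟦ lookup C u ∧ inCluster j u ⟧ ≤ ⟦ lookup C u ⟧
    one-cluster u with lookup C u | label Gc u ≟ᶠ i | label Gc u ≟ᶠ j
    ... | false | _       | _       = z≤n
    ... | true  | yes u∈i | yes u∈j = ⊥-elim (i≢j (trans (sym u∈i) u∈j))
    ... | true  | yes _   | no _    = ≤-refl
    ... | true  | no _    | yes _   = ≤-refl
    ... | true  | no _    | no _    = z≤n

  majority-true : ∀ C j → majority? Gc C j ≡ true → ∣ C ∣ < 2 * ∣ C ∩ D Gc j ∣
  majority-true C j = does-true (∣ C ∣ <? 2 * ∣ C ∩ D Gc j ∣)

  majority-false : ∀ C j → majority? Gc C j ≡ false → 2 * ∣ C ∩ D Gc j ∣ ≤ ∣ C ∣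
  majority-false C j = ≮⇒≥ ∘ does-false (∣ C ∣ <? 2 * ∣ C ∩ D Gc j ∣)

  majority-unique : ∀ C {i j} → majority? Gc C i ≡ true → majority? Gc C j ≡ true → i ≡ j
  majority-unique C {i} {j} maj-i maj-j with i ≟ᶠ j
  ... | yes i≡j = i≡j
  ... | no  i≢j = ⊥-elim (<-irrefl refl (begin-strict
    ∣ C ∣ + ∣ C ∣                               <⟨ +-mono-< (majority-true C i maj-i) (majority-true C j maj-j) ⟩
    2 * ∣ C ∩ D Gc i ∣ + 2 * ∣ C ∩ D Gc j ∣     ≡⟨ *-distribˡ-+ 2 ∣ C ∩ D Gc i ∣ ∣ C ∩ D Gc j ∣ ⟨
    2 * (∣ C ∩ D Gc i ∣ + ∣ C ∩ D Gc j ∣)       ≤⟨ *-monoʳ-≤ 2 (∣∩D∣+∣∩D∣≤∣∣ C i≢j) ⟩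
    2 * ∣ C ∣                                   ≡⟨ cong (∣ C ∣ +_) (+-identityʳ ∣ C ∣) ⟩
    ∣ C ∣ + ∣ C ∣                               ∎))
    where open ≤-Reasoning

  private
    majority-filter : Subset n → List (Fin q)
    majority-filter C = filter (λ i → majority? Gc C i ≟ᵇ true) (allFin q)

    firstJust-nothing : ∀ {A : Set} (xs : List A) → firstJust xs ≡ nothing → xs ≡ []
    firstJust-nothing [] _ = refl

    firstJust-just : ∀ {A : Set} (xs : List A) {a} → firstJust xs ≡ just a → a ∈ xs
    firstJust-just (x ∷ xs) refl = here refl

  T-nothing : ∀ C → T Gc C ≡ nothing → ∀ j → majority? Gc C j ≡ false
  T-nothing C T≡0 j with majority? Gc C j in maj-j
  ... | false = refl
  ... | true  with subst (j ∈_) (firstJust-nothing (majority-filter C) T≡0)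
                     (∈-filter⁺ (λ i → majority? Gc C i ≟ᵇ true) (∈-allFin j) maj-j)
  ... | ()

  T-just : ∀ C {i} → T Gc C ≡ just i → majority? Gc C i ≡ true
  T-just C T≡i = proj₂ (∈-filter⁻ (λ i → majority? Gc C i ≟ᵇ true) {xs = allFin q}
                                  (firstJust-just (majority-filter C) T≡i))

  T-of-majority : ∀ C {j} → majority? Gc C j ≡ true → T Gc C ≡ just j
  T-of-majority C {j} maj-j with T Gc C in T≡
  ... | nothing = contradiction (trans (sym maj-j) (T-nothing C T≡ j)) (λ ())
  ... | just i  = cong just (majority-unique C (T-just C T≡) maj-j)

module Estar {n q r : ℕ} (Gc : ClusterGraph n q) (C : Fin (suc r) → Subset n)
             (disjoint : ∀ i j → i ≢ j → Empty (C i ∩ C j)) where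

  open Clusters Gc

  C₀ : Subset n
  C₀ = C zero

  Cs : Fin r → Subset n
  Cs l = C (suc l)

  U : Fin n → Bool
  U = inUnion Cs

  exclusive : ∀ {i j} u → i ≢ j → lookup (C i) u ≡ true → lookup (C j) u ≡ false
  exclusive {i} {j} u i≢j u∈Cᵢ with lookup (C j) u in u∈Cⱼ
  ... | false = refl
  ... | true  = ⊥-elim (disjoint i j i≢j (u , x∈p∩q⁺ (lookup⇒[]= u (C i) u∈Cᵢ , lookup⇒[]= u (C j) u∈Cⱼ)))

  ⟦U⟧ : ∀ v → ⟦ U v ⟧ ≡ ∑[ l < r ] ⟦ lookup (Cs l) v ⟧
  ⟦U⟧ v = ⟦any⟧ (λ l → lookup (Cs l) v) (λ l → l) (λ l≢l′ → exclusive v (l≢l′ ∘ suc-injective))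

  C₀∩U-empty : ∀ u → lookup C₀ u ≡ true → U u ≡ false
  C₀∩U-empty u u∈C₀ with U u in u∈U
  ... | false = refl
  ... | true  = contradiction
    (trans (sym (cong ⟦_⟧ u∈U)) (trans (⟦U⟧ u)
      (trans (sum-cong-≗ {x = λ l → ⟦ lookup (Cs l) u ⟧} (λ l → cong ⟦_⟧ (exclusive u (λ ()) u∈C₀)))
             (sum-replicate-zero r))))
    (λ ())

  -- The E*-pairs are oriented from C₀ to U, so none is oriented both ways.
  estar-asym : ∀ (Z : Fin n → Fin n → Bool) u v →
    (inEstar C₀ Cs u v ∧ Z u v) ∧ (inEstar C₀ Cs v u ∧ Z v u) ≡ false
  estar-asym Z u v with lookup C₀ u in u∈C₀
  ... | false = refl
  ... | true  rewrite C₀∩U-empty u u∈C₀ | ∧-zeroʳ (lookup C₀ v) = ∧-zeroʳ (U v ∧ Z u v)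

  estar-as-∑ : ∀ (Z : Fin n → Fin n → Bool) →
    countPairs (λ u v → inEstar C₀ Cs u v ∧ Z u v) ≡ ∑[ v < n ] (⟦ U v ⟧ * ∑[ u < n ] ⟦ lookup C₀ u ∧ Z u v ⟧)
  estar-as-∑ Z = begin
    countPairs P                     ≡⟨ countPairs-asym P (estar-asym Z) ⟩
    ∑[ u < n ] ∑[ v < n ] ⟦ P u v ⟧  ≡⟨ ∑-comm (λ u v → ⟦ P u v ⟧) ⟩
    ∑[ v < n ] ∑[ u < n ] ⟦ P u v ⟧  ≡⟨ sum-cong-≗ factor ⟩
    ∑[ v < n ] (⟦ U v ⟧ * ∑[ u < n ] ⟦ lookup C₀ u ∧ Z u v ⟧) ∎
    where
    open ≡-Reasoning
    P : Fin n → Fin n → Bool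
    P u v = inEstar C₀ Cs u v ∧ Z u v
    factor : ∀ v → ∑[ u < n ] ⟦ P u v ⟧ ≡ ⟦ U v ⟧ * ∑[ u < n ] ⟦ lookup C₀ u ∧ Z u v ⟧
    factor v = trans (sum-cong-≗ (λ u → ⟦∧∧⟧ (lookup C₀ u) (U v) (Z u v)))
                     (sym (*-distribˡ-sum ⟦ U v ⟧ (λ u → ⟦ lookup C₀ u ∧ Z u v ⟧)))

  inside : Fin n → ℕ
  inside v = ∣ C₀ ∩ D Gc (label Gc v) ∣

  outside : Fin n → ℕ
  outside v = ∑[ u < n ] ⟦ lookup C₀ u ∧ not (adjC Gc u v) ⟧

  inside+outside : ∀ v → inside v + outside v ≡ ∣ C₀ ∣
  inside+outside v = trans (cong (_+ outside v) (∣∩D∣-as-∑ C₀ (label Gc v)))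
                           (trans (∑-split (lookup C₀) (λ u → adjC Gc u v)) (sym (∣∣-as-∑ C₀)))

  EstarInGc-as-∑ : EstarInGc Gc C₀ Cs ≡ ∑[ v < n ] (⟦ U v ⟧ * inside v)
  EstarInGc-as-∑ = trans (estar-as-∑ (adjC Gc))
    (sum-cong-≗ (λ v → cong (⟦ U v ⟧ *_) (sym (∣∩D∣-as-∑ C₀ (label Gc v)))))

  EstarNotGc-as-∑ : EstarNotGc Gc C₀ Cs ≡ ∑[ v < n ] (⟦ U v ⟧ * outside v)
  EstarNotGc-as-∑ = estar-as-∑ (λ u v → not (adjC Gc u v))

  -- Case T(C₀) = 0: no vertex sees a majority of C₀ in its own cluster.
  balanced-case : T Gc C₀ ≡ nothing →
    ∑[ v < n ] (⟦ U v ⟧ * inside v) ≤ ∑[ v < n ] (⟦ U v ⟧ * outside v)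
  balanced-case T≡0 = ∑-mono-≤ (λ v → *-monoʳ-≤ ⟦ U v ⟧ (inside≤outside v))
    where
    inside≤outside : ∀ v → inside v ≤ outside v
    inside≤outside v = +-cancelˡ-≤ (inside v) (inside v) (outside v) (begin
      inside v + inside v   ≡⟨ cong (inside v +_) (+-identityʳ (inside v)) ⟨
      2 * inside v          ≤⟨ majority-false C₀ (label Gc v) (T-nothing C₀ T≡0 (label Gc v)) ⟩
      ∣ C₀ ∣                ≡⟨ inside+outside v ⟨
      inside v + outside v  ∎)
      where open ≤-Reasoning

  minority-in-U : ∀ {i} → (∀ l → majority? Gc (Cs l) i ≡ false) →
    ∑[ v < n ] ⟦ U v ∧ inCluster i v ⟧ ≤ ∑[ v < n ] ⟦ U v ∧ not (inCluster i v) ⟧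
  minority-in-U {i} minority = +-cancelˡ-≤ M M P (begin
    M + M                               ≡⟨ cong (M +_) (+-identityʳ M) ⟨
    2 * M                               ≡⟨ cong (2 *_) M-as-∑ ⟩
    2 * ∑[ l < r ] ∣ Cs l ∩ D Gc i ∣    ≡⟨ *-distribˡ-sum 2 (λ l → ∣ Cs l ∩ D Gc i ∣) ⟩
    ∑[ l < r ] (2 * ∣ Cs l ∩ D Gc i ∣)  ≤⟨ ∑-mono-≤ (λ l → majority-false (Cs l) i (minority l)) ⟩
    ∑[ l < r ] ∣ Cs l ∣                 ≡⟨ ∣U∣-as-∑ ⟨
    ∑[ v < n ] ⟦ U v ⟧                  ≡⟨ ∑-split U (inCluster i) ⟨
    M + P                               ∎)
    where
    open ≤-Reasoning
    M P : ℕ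
    M = ∑[ v < n ] ⟦ U v ∧ inCluster i v ⟧
    P = ∑[ v < n ] ⟦ U v ∧ not (inCluster i v) ⟧
    pointwise : ∀ v → ⟦ U v ∧ inCluster i v ⟧ ≡ ∑[ l < r ] ⟦ lookup (Cs l) v ∧ inCluster i v ⟧
    pointwise v = begin-equality
      ⟦ U v ∧ inCluster i v ⟧                              ≡⟨ ⟦∧⟧ (U v) (inCluster i v) ⟩
      ⟦ U v ⟧ * ⟦ inCluster i v ⟧                          ≡⟨ cong (_* ⟦ inCluster i v ⟧) (⟦U⟧ v) ⟩
      (∑[ l < r ] ⟦ lookup (Cs l) v ⟧) * ⟦ inCluster i v ⟧ ≡⟨ *-distribʳ-sum ⟦ inCluster i v ⟧ (λ l → ⟦ lookup (Cs l) v ⟧) ⟩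
      ∑[ l < r ] (⟦ lookup (Cs l) v ⟧ * ⟦ inCluster i v ⟧) ≡⟨ sum-cong-≗ (λ l → ⟦∧⟧ (lookup (Cs l) v) (inCluster i v)) ⟨
      ∑[ l < r ] ⟦ lookup (Cs l) v ∧ inCluster i v ⟧       ∎
    M-as-∑ : M ≡ ∑[ l < r ] ∣ Cs l ∩ D Gc i ∣
    M-as-∑ = trans (sum-cong-≗ pointwise)
      (trans (∑-comm (λ v l → ⟦ lookup (Cs l) v ∧ inCluster i v ⟧))
             (sym (sum-cong-≗ (λ l → ∣∩D∣-as-∑ (Cs l) i))))
    ∣U∣-as-∑ : ∑[ v < n ] ⟦ U v ⟧ ≡ ∑[ l < r ] ∣ Cs l ∣
    ∣U∣-as-∑ = trans (sum-cong-≗ ⟦U⟧)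
      (trans (∑-comm (λ v l → ⟦ lookup (Cs l) v ⟧)) (sym (sum-cong-≗ (λ l → ∣∣-as-∑ (Cs l)))))

  -- Case T(C₀) = i where D_i is a majority in none of the Cₗ: with
  -- c = |C₀ ∩ D_i| and e = |C₀| - c, vertices of U in D_i have in = c and
  -- out = e, the others in ≤ e and out ≥ c; conclude by the exchange inequality.
  foreign-majority-case : ∀ {i} → T Gc C₀ ≡ just i → (∀ l → majority? Gc (Cs l) i ≡ false) →
    ∑[ v < n ] (⟦ U v ⟧ * inside v) ≤ ∑[ v < n ] (⟦ U v ⟧ * outside v)
  foreign-majority-case {i} T≡i minority =
    exchange (λ v → ⟦ U v ∧ inCluster i v ⟧) (λ v → ⟦ U v ∧ not (inCluster i v) ⟧)
             (λ v → ⟦ U v ⟧ * inside v) (λ v → ⟦ U v ⟧ * outside v)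
             e≤c (minority-in-U minority)
             (λ v → weighted-≤ (U v) (inCluster i v) (≤-reflexive ∘ inside-in v) (inside-out v))
             (λ v → weighted-≥ (U v) (inCluster i v) (≤-reflexive ∘ sym ∘ outside-in v) (outside-out v))
    where
    c e : ℕ
    c = ∣ C₀ ∩ D Gc i ∣
    e = ∣ C₀ ∣ ∸ c
    c+e : c + e ≡ ∣ C₀ ∣
    c+e = m+[n∸m]≡n (∣p∩q∣≤∣p∣ C₀ (D Gc i))
    e≤c : e ≤ c
    e≤c = <⇒≤ (+-cancelˡ-< c e c (begin-strict
      c + e      ≡⟨ c+e ⟩
      ∣ C₀ ∣     <⟨ majority-true C₀ i (T-just C₀ T≡i) ⟩
      2 * c      ≡⟨ cong (c +_) (+-identityʳ c) ⟩
      c + c      ∎))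
      where open ≤-Reasoning
    off-cluster : ∀ v → inCluster i v ≡ false → inside v + c ≤ ∣ C₀ ∣
    off-cluster v v∉Dᵢ = ∣∩D∣+∣∩D∣≤∣∣ C₀ (does-false (label Gc v ≟ᶠ i) v∉Dᵢ)
    inside-in : ∀ v → inCluster i v ≡ true → inside v ≡ c
    inside-in v v∈Dᵢ = cong (λ j → ∣ C₀ ∩ D Gc j ∣) (does-true (label Gc v ≟ᶠ i) v∈Dᵢ)
    outside-in : ∀ v → inCluster i v ≡ true → outside v ≡ e
    outside-in v v∈Dᵢ = +-cancelˡ-≡ c (outside v) e
      (trans (cong (_+ outside v) (sym (inside-in v v∈Dᵢ))) (trans (inside+outside v) (sym c+e)))
    inside-out : ∀ v → inCluster i v ≡ false → inside v ≤ e
    inside-out v v∉Dᵢ = +-cancelʳ-≤ c (inside v) e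
      (subst (inside v + c ≤_) (trans (sym c+e) (+-comm c e)) (off-cluster v v∉Dᵢ))
    outside-out : ∀ v → inCluster i v ≡ false → c ≤ outside v
    outside-out v v∉Dᵢ = +-cancelˡ-≤ (inside v) c (outside v)
      (subst (inside v + c ≤_) (sym (inside+outside v)) (off-cluster v v∉Dᵢ))

  -- If T(Cₗ) differs from i for every l, then D_i is a majority of no Cₗ,
  -- since a majority cluster is the value of T.
  elsewhere-minority : ∀ {i} → (∀ l → just i ≢ T Gc (Cs l)) → ∀ l → majority? Gc (Cs l) i ≡ false
  elsewhere-minority {i} distinct l with majority? Gc (Cs l) i in maj
  ... | false = refl
  ... | true  = ⊥-elim (distinct l (sym (T-of-majority (Cs l) maj)))

  estar-balance : T Gc C₀ ≡ nothing ⊎ (∀ l → T Gc C₀ ≢ T Gc (Cs l)) →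
    ∑[ v < n ] (⟦ U v ⟧ * inside v) ≤ ∑[ v < n ] (⟦ U v ⟧ * outside v)
  estar-balance (inj₁ T≡0) = balanced-case T≡0
  estar-balance (inj₂ distinct) with T Gc C₀ in T≡
  ... | nothing = balanced-case T≡
  ... | just i  = foreign-majority-case T≡ (elsewhere-minority distinct)

lemma32 : ∀ {n q} (G : Graph n) (Gc : ClusterGraph n q) (k d r : ℕ) → 1 ≤ r →
    (C : Fin (suc r) → Subset n) →
    (∀ i → IsolatedClique G (C i)) →
    (∀ i j → ¬ i ≡ j → Empty (C i ∩ C j)) →
    (T Gc (C zero) ≡ nothing ⊎ (∀ (i : Fin r) → ¬ T Gc (C zero) ≡ T Gc (C (suc i)))) →
    EstarInGc Gc (C zero) (λ i → C (suc i)) ≤ EstarNotGc Gc (C zero) (λ i → C (suc i))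
lemma32 G Gc k d r _ C _ disjoint T-hypothesis =
  subst₂ _≤_ (sym EstarInGc-as-∑) (sym EstarNotGc-as-∑) (estar-balance T-hypothesis)
  where open Estar Gc C disjoint
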